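{- Let $\mathcal{B}$ be a block schema such that $\vdash\mathcal{B}$ (i.e. $\mathcal{B}$ is well-formed) is derivable. Then for any variable permutation $\pi$, $\vdash\pi.\mathcal{B}$ is derivable.
   Context: Canonical LF over a fixed well-formed signature $\Sigma$: types $A ::= P\mid\Pi x{:}A.B$, $P ::= a\mid P\,M$, terms $M ::= R\mid\lambda x.M$, $R ::= c\mid x\mid R\,M$ (only $\beta$-normal forms). Arity types are simple types over one base type $o$ built with $\to$; erasure: $P^-=o$, $(\Pi x{:}A_1.A_2)^-=A_1^-\to A_2^-$; $\Sigma^-=\{c{:}A^-\mid c{:}A\in\Sigma\}$. An arity context $\Theta$ assigns arity types to constants, nominal constants and variables; $\Theta\vdash A$ (arity kinding) checks that a type is canonical and respects the functional structure given by erased types. A substitution is a finite set $\theta=\{\langle x_i,M_i,\alpha_i\rangle\}$ (distinct variables, canonical terms, arity types); $E[\theta]$ is its hereditary application (capture-avoiding replacement followed by normalization guided by the arity types), possibly undefined. Block schemas. Block declarations $\Delta ::= \cdot\mid\Delta,y{:}A$; block schemas $\mathcal{B}=\{x_1{:}\alpha_1,\ldots,x_n{:}\alpha_n\}\Delta$. Well-formedness $\vdash\mathcal{B}$: the $x_i$ are distinct variables and $\Sigma^-\cup\{x_1{:}\alpha_1,\ldots,x_n{:}\alpha_n\}\vdash\Delta\Rightarrow\Theta'$ for some $\Theta'$, where $\Theta\vdash\cdot\Rightarrow\Theta$, and $\Theta\vdash\Delta,y{:}A\Rightarrow\Theta'\cup\{y{:}A^-\}$ whenever $\Theta\vdash\Delta\Rightarrow\Theta'$,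 $y$ is not assigned by $\Theta'$, and $\Theta'\vdash A$. Variants. A variable permutation $\pi$ is a bijection on variables that is the identity except at finitely many points; $\pi.x$ is its value at $x$. For an arity context $\Theta$, the permutation substitution is $\pi_\Theta=\{\langle x,\pi.x,\alpha'\rangle\mid\pi.x\ne x\}$ with $\alpha'=\alpha$ if $x{:}\alpha\in\Theta$ and $\alpha'=o$ otherwise. For $\mathcal{B}=\{x_1{:}\alpha_1,\ldots,x_n{:}\alpha_n\}y_1{:}A_1,\ldots,y_m{:}A_m$, let $\Theta_{\mathcal{B}}=\Sigma^-\cup\{x_1{:}\alpha_1,\ldots,x_n{:}\alpha_n,y_1{:}A_1^-,\ldots,y_m{:}A_m^-\}$ and $\pi.\mathcal{B}=\{\pi.x_1{:}\alpha_1,\ldots,\pi.x_n{:}\alpha_n\}\,\pi.y_1{:}A_1[\pi_{\Theta_{\mathcal{B}}}],\ldots,\pi.y_m{:}A_m[\pi_{\Theta_{\mathcal{B}}}]$; these hereditary substitutions are defined under the well-formedness assumption. -}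

module Defs where

-- Canonical LF syntax in locally nameless style: free variables,
-- constants and nominal constants are named by natural numbers; variables
-- bound by λ and Π are de Bruijn indices (this represents terms up to α).

open import Data.Nat using (ℕ; zero; suc; _+_; _∸_; _<?_; _≟_)
open import Data.List using (List; []; _∷_; _++_; map; filter)
open import Data.List.Membership.Propositional using (_∈_; _∉_)
open import Data.List.Relation.Unary.Unique.Propositional using (Unique)
open import Data.Maybe using (Maybe; just; nothing; _>>=_)
open import Data.Product using (_×_; _,_; proj₁; ∃)
open import Relation.Binary.PropositionalEquality using (_≡_)
open import Relation.Nullary using (yes; no; ¬_; ¬?)

data ArTy : Set where
  o   : ArTy
  _⇒_ : ArTy → ArTy → ArTy

infixr 5 _⇒_

-- Canonical terms  M ::= R | λ.M ,  R ::= h M1 ... Mn  (spine form of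
-- R ::= c | x | n | R M), heads: constants, (free) variables, nominal
-- constants, bound (de Bruijn) variables.

data Head : Set where
  con  : ℕ → Head
  fvar : ℕ → Head
  nom  : ℕ → Head
  bvar : ℕ → Head

data Tm : Set where
  lam : Tm → Tm
  rt  : Head → List Tm → Tm

data Ty : Set where
  base : ℕ → List Tm → Ty
  pi   : Ty → Ty → Ty

data Kind : Set where
  type : Kind
  kpi  : Ty → Kind → Kind

record Sig : Set where
  field
    consts : List (ℕ × Ty)
    fams   : List (ℕ × Kind)
open Sig public

_⁻ : Ty → ArTy
base _ _ ⁻ = o
pi A B ⁻   = (A ⁻) ⇒ (B ⁻)

kind⁻ : Kind → List ArTy
kind⁻ type      = []
kind⁻ (kpi A K) = (A ⁻) ∷ kind⁻ K

data Name : Set where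
  cN : ℕ → Name
  nN : ℕ → Name
  vN : ℕ → Name

ACtx : Set
ACtx = List (Name × ArTy)

sig⁻ : Sig → ACtx
sig⁻ S = map (λ p → (cN (proj₁ p) , (Data.Product.proj₂ p) ⁻)) (consts S)

nth : {A : Set} → List A → ℕ → Maybe A
nth []       _       = nothing
nth (x ∷ xs) zero    = just x
nth (x ∷ xs) (suc i) = nth xs i

-- Arity typing / kinding (relative to the fixed signature S for type
-- families).  Γ gives arity types of the de Bruijn-bound variables.
-- Canonical terms are checked in η-long form: an atomic term is a
-- canonical term only at arity o.

data HeadAr (Θ : ACtx) (Γ : List ArTy) : Head → ArTy → Set where
  hcon  : ∀ {c α} → (cN c , α) ∈ Θ → HeadAr Θ Γ (con c) α
  hvar  : ∀ {x α} → (vN x , α) ∈ Θ → HeadAr Θ Γ (fvar x) α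
  hnom  : ∀ {n α} → (nN n , α) ∈ Θ → HeadAr Θ Γ (nom n) α
  hbvar : ∀ {i α} → nth Γ i ≡ just α → HeadAr Θ Γ (bvar i) α

mutual
  data TmAr (Θ : ACtx) (Γ : List ArTy) : Tm → ArTy → Set where
    ar-lam : ∀ {M α β} → TmAr Θ (α ∷ Γ) M β → TmAr Θ Γ (lam M) (α ⇒ β)
    ar-rt  : ∀ {h Ms α} → HeadAr Θ Γ h α → SpAr Θ Γ Ms α o → TmAr Θ Γ (rt h Ms) o

  data SpAr (Θ : ACtx) (Γ : List ArTy) : List Tm → ArTy → ArTy → Set where
    sp-nil  : ∀ {α} → SpAr Θ Γ [] α α
    sp-cons : ∀ {M Ms α β γ} → TmAr Θ Γ M α → SpAr Θ Γ Ms β γ →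
              SpAr Θ Γ (M ∷ Ms) (α ⇒ β) γ

data FSpAr (Θ : ACtx) (Γ : List ArTy) : List Tm → List ArTy → Set where
  fsp-nil  : FSpAr Θ Γ [] []
  fsp-cons : ∀ {M Ms α αs} → TmAr Θ Γ M α → FSpAr Θ Γ Ms αs →
             FSpAr Θ Γ (M ∷ Ms) (α ∷ αs)

data TyAr (S : Sig) (Θ : ACtx) (Γ : List ArTy) : Ty → Set where
  ak-base : ∀ {a K Ms} → (a , K) ∈ fams S → FSpAr Θ Γ Ms (kind⁻ K) →
            TyAr S Θ Γ (base a Ms)
  ak-pi   : ∀ {A B} → TyAr S Θ Γ A → TyAr S Θ ((A ⁻) ∷ Γ) B →
            TyAr S Θ Γ (pi A B)

_⊢[_]_ : ACtx → Sig → Ty → Set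
Θ ⊢[ S ] A = TyAr S Θ [] A

data Decls : Set where
  ·     : Decls
  _,_∶_ : Decls → ℕ → Ty → Decls

infixl 4 _,_∶_

record Block : Set where
  constructor ⟪_⟫_
  field
    params : List (ℕ × ArTy)
    decls  : Decls
open Block public

paramCtx : List (ℕ × ArTy) → ACtx
paramCtx = map (λ p → (vN (proj₁ p) , Data.Product.proj₂ p))

data DeclsWF (S : Sig) : ACtx → Decls → ACtx → Set where
  dwf-nil  : ∀ {Θ} → DeclsWF S Θ · Θ
  dwf-snoc : ∀ {Θ Θ' Δ y A} → DeclsWF S Θ Δ Θ' →
             (∀ α → (vN y , α) ∉ Θ') →
             Θ' ⊢[ S ] A →
             DeclsWF S Θ (Δ , y ∶ A) ((vN y , A ⁻) ∷ Θ')

WFBlock : Sig → Block → Set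
WFBlock S B =
  Unique (map proj₁ (params B)) ×
  ∃ λ Θ' → DeclsWF S (sig⁻ S ++ paramCtx (params B)) (decls B) Θ'

mutual
  shiftTm : ℕ → ℕ → Tm → Tm
  shiftTm c n (lam M)   = lam (shiftTm (suc c) n M)
  shiftTm c n (rt h Ms) = rt (shiftHd c n h) (shiftSp c n Ms)

  shiftSp : ℕ → ℕ → List Tm → List Tm
  shiftSp c n []       = []
  shiftSp c n (M ∷ Ms) = shiftTm c n M ∷ shiftSp c n Ms

  shiftHd : ℕ → ℕ → Head → Head
  shiftHd c n (bvar i) with i <? c
  ... | yes _ = bvar i
  ... | no  _ = bvar (i + n)
  shiftHd c n h = h

mutual
  instTm : ArTy → ℕ → Tm → Tm → Maybe Tm
  instTm α k N (lam M)   = instTm α (suc k) (shiftTm 0 1 N) M >>= λ M' → just (lam M')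
  instTm α k N (rt h Ms) = instSp α k N Ms >>= λ Ms' → instHd α k N h Ms'

  instHd : ArTy → ℕ → Tm → Head → List Tm → Maybe Tm
  instHd α k N (bvar i) Ms' with i ≟ k
  ... | yes _ = reduce α N Ms'
  ... | no  _ with i <? k
  ...   | yes _ = just (rt (bvar i) Ms')
  ...   | no  _ = just (rt (bvar (i ∸ 1)) Ms')
  instHd α k N h Ms' = just (rt h Ms')

  instSp : ArTy → ℕ → Tm → List Tm → Maybe (List Tm)
  instSp α k N []       = just []
  instSp α k N (M ∷ Ms) =
    instTm α k N M >>= λ M' → instSp α k N Ms >>= λ Ms' → just (M' ∷ Ms')

  reduce : ArTy → Tm → List Tm → Maybe Tm
  reduce α         M         []       = just M
  reduce (α₁ ⇒ α₂) (lam B)   (N ∷ Ns) = instTm α₁ 0 N B >>= λ B' → reduce α₂ B' Ns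
  reduce o         (lam B)   (N ∷ Ns) = nothing
  reduce α         (rt h Ms) (N ∷ Ns) = just (rt h (Ms ++ (N ∷ Ns)))

Subst : Set
Subst = List (ℕ × Tm × ArTy)

lookupSub : Subst → ℕ → Maybe (Tm × ArTy)
lookupSub []                  x = nothing
lookupSub ((y , M , α) ∷ θ) x with y ≟ x
... | yes _ = just (M , α)
... | no  _ = lookupSub θ x

mutual
  hsubTm : Subst → ℕ → Tm → Maybe Tm
  hsubTm θ d (lam M)   = hsubTm θ (suc d) M >>= λ M' → just (lam M')
  hsubTm θ d (rt h Ms) = hsubSp θ d Ms >>= λ Ms' → hsubHd θ d h Ms'

  hsubHd : Subst → ℕ → Head → List Tm → Maybe Tm
  hsubHd θ d (fvar x) Ms' with lookupSub θ x
  ... | just (M , α) = reduce α (shiftTm 0 d M) Ms'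
  ... | nothing      = just (rt (fvar x) Ms')
  hsubHd θ d h Ms' = just (rt h Ms')

  hsubSp : Subst → ℕ → List Tm → Maybe (List Tm)
  hsubSp θ d []       = just []
  hsubSp θ d (M ∷ Ms) =
    hsubTm θ d M >>= λ M' → hsubSp θ d Ms >>= λ Ms' → just (M' ∷ Ms')

hsubTy' : Subst → ℕ → Ty → Maybe Ty
hsubTy' θ d (base a Ms) = hsubSp θ d Ms >>= λ Ms' → just (base a Ms')
hsubTy' θ d (pi A B)    =
  hsubTy' θ d A >>= λ A' → hsubTy' θ (suc d) B >>= λ B' → just (pi A' B')

_[_] : Ty → Subst → Maybe Ty
A [ θ ] = hsubTy' θ 0 A

record Perm : Set where
  field
    fun     : ℕ → ℕ
    inv     : ℕ → ℕ
    inv-fun : ∀ x → inv (fun x) ≡ x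
    fun-inv : ∀ x → fun (inv x) ≡ x
    supp    : List ℕ
    finite  : ∀ x → x ∉ supp → fun x ≡ x
open Perm public

lookupVar : ACtx → ℕ → Maybe ArTy
lookupVar []                  x = nothing
lookupVar ((vN y , α) ∷ Θ) x with y ≟ x
... | yes _ = just α
... | no  _ = lookupVar Θ x
lookupVar ((cN _ , _) ∷ Θ) x = lookupVar Θ x
lookupVar ((nN _ , _) ∷ Θ) x = lookupVar Θ x

arityOr-o : ACtx → ℕ → ArTy
arityOr-o Θ x with lookupVar Θ x
... | just α  = α
... | nothing = o

permSubst : Perm → ACtx → Subst
permSubst π Θ =
  map (λ x → (x , rt (fvar (fun π x)) [] , arityOr-o Θ x))
      (filter (λ x → ¬? (fun π x ≟ x)) (supp π))

declsCtx : Decls → ACtx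
declsCtx ·           = []
declsCtx (Δ , y ∶ A) = (vN y , A ⁻) ∷ declsCtx Δ

blockCtx : Sig → Block → ACtx
blockCtx S B = sig⁻ S ++ paramCtx (params B) ++ declsCtx (decls B)

permDecls : Perm → Subst → Decls → Maybe Decls
permDecls π θ ·           = just ·
permDecls π θ (Δ , y ∶ A) =
  permDecls π θ Δ >>= λ Δ' → A [ θ ] >>= λ A' → just (Δ' , fun π y ∶ A')

permBlock : Sig → Perm → Block → Maybe Block
permBlock S π B =
  permDecls π (permSubst π (blockCtx S B)) (decls B) >>= λ Δ' →
  just (⟪ map (λ p → (fun π (proj₁ p) , Data.Product.proj₂ p)) (params B) ⟫ Δ')

-- A permutation substitution replaces variables by variables, so its hereditary
-- application never meets a β-redex: it is always defined and coincides with the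
-- plain renaming by π. Well-formedness of blocks is stable under renaming by
-- an injective map, because arity typing only consults the context by
-- membership and renaming the context along with the block preserves it; the
-- freshness side conditions survive by injectivity.
module Submission where

open import Defs
open import Data.Product using (∃; _×_; _,_; proj₁; proj₂)
open import Data.Maybe using (Maybe; just; nothing; _>>=_)
open import Relation.Binary.PropositionalEquality using (_≡_; refl; sym; trans; cong; cong₂; subst; module ≡-Reasoning)
open import Data.Empty using (⊥-elim)
open import Data.List using (List; []; _∷_; _++_; map; filter)
open import Data.List.Properties using (map-++; map-∘)
open import Data.List.Membership.Propositional using (_∉_)
open import Data.List.Membership.Propositional.Properties using (∈-filter⁺; ∈-map⁺; ∈-map⁻)
open import Data.List.Relation.Unary.Any using (here; there)
open import Data.List.Relation.Unary.Unique.Propositional using (Unique)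
open import Data.List.Relation.Unary.Unique.Propositional.Properties using () renaming (map⁺ to Unique-map⁺)
open import Data.Nat using (ℕ; suc; _≟_)
open import Data.List.Membership.DecPropositional _≟_ using (_∈?_)
open import Function.Definitions using (Injective)
open import Relation.Nullary using (yes; no; ¬?)
open ≡-Reasoning

vN-injective : ∀ {a b} → vN a ≡ vN b → a ≡ b
vN-injective refl = refl

module Renaming (f : ℕ → ℕ) where

  mutual
    renameTm : Tm → Tm
    renameTm (lam M)   = lam (renameTm M)
    renameTm (rt h Ms) = rt (renameHd h) (renameSp Ms)

    renameSp : List Tm → List Tm
    renameSp []       = []
    renameSp (M ∷ Ms) = renameTm M ∷ renameSp Ms

    renameHd : Head → Head
    renameHd (fvar x) = fvar (f x)
    renameHd h        = h

  renameTy : Ty → Ty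
  renameTy (base a Ms) = base a (renameSp Ms)
  renameTy (pi A B)    = pi (renameTy A) (renameTy B)

  renameDecls : Decls → Decls
  renameDecls ·           = ·
  renameDecls (Δ , y ∶ A) = renameDecls Δ , f y ∶ renameTy A

  renameName : Name → Name
  renameName (vN x) = vN (f x)
  renameName n      = n

  renameEntry : Name × ArTy → Name × ArTy
  renameEntry (n , α) = renameName n , α

  renameCtx : ACtx → ACtx
  renameCtx = map renameEntry

  renameParams : List (ℕ × ArTy) → List (ℕ × ArTy)
  renameParams = map (λ p → f (proj₁ p) , proj₂ p)

  renameCtx-sig⁻ : ∀ S → renameCtx (sig⁻ S) ≡ sig⁻ S
  renameCtx-sig⁻ S = sym (map-∘ (consts S))

  renameCtx-paramCtx : ∀ ps → renameCtx (paramCtx ps) ≡ paramCtx (renameParams ps)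
  renameCtx-paramCtx ps = trans (sym (map-∘ ps)) (map-∘ ps)

  names-renameParams : ∀ ps → map proj₁ (renameParams ps) ≡ map f (map proj₁ ps)
  names-renameParams ps = trans (sym (map-∘ ps)) (map-∘ ps)

  ⁻-renameTy : ∀ A → renameTy A ⁻ ≡ A ⁻
  ⁻-renameTy (base _ _) = refl
  ⁻-renameTy (pi A B)   = cong₂ _⇒_ (⁻-renameTy A) (⁻-renameTy B)

  HeadAr-rename : ∀ {Θ Γ h α} → HeadAr Θ Γ h α → HeadAr (renameCtx Θ) Γ (renameHd h) α
  HeadAr-rename (hcon c∈)  = hcon (∈-map⁺ renameEntry c∈)
  HeadAr-rename (hvar x∈)  = hvar (∈-map⁺ renameEntry x∈)
  HeadAr-rename (hnom n∈)  = hnom (∈-map⁺ renameEntry n∈)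
  HeadAr-rename (hbvar eq) = hbvar eq

  mutual
    TmAr-rename : ∀ {Θ Γ M α} → TmAr Θ Γ M α → TmAr (renameCtx Θ) Γ (renameTm M) α
    TmAr-rename (ar-lam M)   = ar-lam (TmAr-rename M)
    TmAr-rename (ar-rt h Ms) = ar-rt (HeadAr-rename h) (SpAr-rename Ms)

    SpAr-rename : ∀ {Θ Γ Ms α β} → SpAr Θ Γ Ms α β → SpAr (renameCtx Θ) Γ (renameSp Ms) α β
    SpAr-rename sp-nil         = sp-nil
    SpAr-rename (sp-cons M Ms) = sp-cons (TmAr-rename M) (SpAr-rename Ms)

  FSpAr-rename : ∀ {Θ Γ Ms αs} → FSpAr Θ Γ Ms αs → FSpAr (renameCtx Θ) Γ (renameSp Ms) αs
  FSpAr-rename fsp-nil         = fsp-nil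
  FSpAr-rename (fsp-cons M Ms) = fsp-cons (TmAr-rename M) (FSpAr-rename Ms)

  TyAr-rename : ∀ {S Θ Γ A} → TyAr S Θ Γ A → TyAr S (renameCtx Θ) Γ (renameTy A)
  TyAr-rename (ak-base a∈ Ms) = ak-base a∈ (FSpAr-rename Ms)
  TyAr-rename {S} {Θ} {Γ} (ak-pi {A} {B} ⊢A ⊢B) =
    ak-pi (TyAr-rename ⊢A)
          (subst (λ α → TyAr S (renameCtx Θ) (α ∷ Γ) (renameTy B)) (sym (⁻-renameTy A)) (TyAr-rename ⊢B))

  module _ (f-injective : Injective _≡_ _≡_ f) where

    fresh-rename : ∀ {Θ y} → (∀ α → (vN y , α) ∉ Θ) → ∀ α → (vN (f y) , α) ∉ renameCtx Θ
    fresh-rename y-fresh α fy∈ with ∈-map⁻ renameEntry fy∈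
    ... | (cN _ , _) , _ , ()
    ... | (nN _ , _) , _ , ()
    ... | (vN z , β) , z∈ , eq with f-injective (vN-injective (cong proj₁ eq)) | cong proj₂ eq
    ...   | refl | refl = y-fresh α z∈

    DeclsWF-rename : ∀ {S Θ Δ Θ'} → DeclsWF S Θ Δ Θ' →
                     DeclsWF S (renameCtx Θ) (renameDecls Δ) (renameCtx Θ')
    DeclsWF-rename dwf-nil = dwf-nil
    DeclsWF-rename {S} {Θ} (dwf-snoc {Θ' = Θ'} {Δ} {y} {A} ⊢Δ y-fresh ⊢A) =
      subst (λ α → DeclsWF S (renameCtx Θ) (renameDecls Δ , f y ∶ renameTy A) ((vN (f y) , α) ∷ renameCtx Θ'))
            (⁻-renameTy A)
            (dwf-snoc (DeclsWF-rename ⊢Δ) (fresh-rename y-fresh) (TyAr-rename ⊢A))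

open Renaming

-- The arity stored with a renamed variable is irrelevant: a bare head applied
-- to a spine never forms a redex (reduce-fvar).
data RenamingEntry (f : ℕ → ℕ) (x : ℕ) : Maybe (Tm × ArTy) → Set where
  unchanged : f x ≡ x → RenamingEntry f x nothing
  renamed   : ∀ α → RenamingEntry f x (just (rt (fvar (f x)) [] , α))

IsRenaming : (ℕ → ℕ) → Subst → Set
IsRenaming f θ = ∀ x → RenamingEntry f x (lookupSub θ x)

reduce-fvar : ∀ α y Ms → reduce α (rt (fvar y) []) Ms ≡ just (rt (fvar y) Ms)
reduce-fvar α       y []       = refl
reduce-fvar o       y (_ ∷ _) = refl
reduce-fvar (_ ⇒ _) y (_ ∷ _) = refl

module _ {f : ℕ → ℕ} {θ : Subst} (θ-renames : IsRenaming f θ) where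

  hsubHd-renaming : ∀ d h Ms → hsubHd θ d h Ms ≡ just (rt (renameHd f h) Ms)
  hsubHd-renaming d (con _)  Ms = refl
  hsubHd-renaming d (nom _)  Ms = refl
  hsubHd-renaming d (bvar _) Ms = refl
  hsubHd-renaming d (fvar x) Ms with lookupSub θ x | θ-renames x
  ... | just _  | renamed α    = reduce-fvar α (f x) Ms
  ... | nothing | unchanged fx = cong (λ y → just (rt (fvar y) Ms)) (sym fx)

  mutual
    hsubTm-renaming : ∀ d M → hsubTm θ d M ≡ just (renameTm f M)
    hsubTm-renaming d (lam M)   rewrite hsubTm-renaming (suc d) M = refl
    hsubTm-renaming d (rt h Ms) rewrite hsubSp-renaming d Ms = hsubHd-renaming d h (renameSp f Ms)

    hsubSp-renaming : ∀ d Ms → hsubSp θ d Ms ≡ just (renameSp f Ms)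
    hsubSp-renaming d []       = refl
    hsubSp-renaming d (M ∷ Ms) rewrite hsubTm-renaming d M | hsubSp-renaming d Ms = refl

  hsubTy-renaming : ∀ d A → hsubTy' θ d A ≡ just (renameTy f A)
  hsubTy-renaming d (base a Ms) rewrite hsubSp-renaming d Ms = refl
  hsubTy-renaming d (pi A B)    rewrite hsubTy-renaming d A | hsubTy-renaming (suc d) B = refl

module _ (π : Perm) where

  fun-injective : Injective _≡_ _≡_ (fun π)
  fun-injective {x} {y} eq = trans (sym (inv-fun π x)) (trans (cong (inv π) eq) (inv-fun π y))

  moved : List ℕ
  moved = filter (λ x → ¬? (fun π x ≟ x)) (supp π)

  fixed-outside-moved : ∀ x → x ∉ moved → fun π x ≡ x
  fixed-outside-moved x x∉ with fun π x ≟ x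
  ... | yes fixed = fixed
  ... | no  moves with x ∈? supp π
  ...   | yes x∈ = ⊥-elim (x∉ (∈-filter⁺ (λ x → ¬? (fun π x ≟ x)) x∈ moves))
  ...   | no  x∉supp = finite π x x∉supp

  lookupSub-permEntries : ∀ Θ L x → (x ∉ L → fun π x ≡ x) →
    RenamingEntry (fun π) x (lookupSub (map (λ x → (x , rt (fvar (fun π x)) [] , arityOr-o Θ x)) L) x)
  lookupSub-permEntries Θ []      x fixed = unchanged (fixed λ ())
  lookupSub-permEntries Θ (y ∷ L) x fixed with y ≟ x
  ... | yes refl = renamed (arityOr-o Θ y)
  ... | no  y≢x  = lookupSub-permEntries Θ L x
                     (λ x∉L → fixed λ { (here refl) → y≢x refl ; (there x∈L) → x∉L x∈L })

  permSubst-isRenaming : ∀ Θ → IsRenaming (fun π) (permSubst π Θ)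
  permSubst-isRenaming Θ x = lookupSub-permEntries Θ moved x (fixed-outside-moved x)

  permDecls-permSubst : ∀ Θ Δ → permDecls π (permSubst π Θ) Δ ≡ just (renameDecls (fun π) Δ)
  permDecls-permSubst Θ ·           = refl
  permDecls-permSubst Θ (Δ , y ∶ A) =
    cong₂ (λ mΔ mA → mΔ >>= λ Δ' → mA >>= λ A' → just (Δ' , fun π y ∶ A'))
          (permDecls-permSubst Θ Δ) (hsubTy-renaming (permSubst-isRenaming Θ) 0 A)

  permBlock-renames : ∀ S ps Δ →
    permBlock S π (⟪ ps ⟫ Δ) ≡ just (⟪ renameParams (fun π) ps ⟫ renameDecls (fun π) Δ)
  permBlock-renames S ps Δ =
    cong (_>>= λ Δ' → just (⟪ renameParams (fun π) ps ⟫ Δ')) (permDecls-permSubst (blockCtx S (⟪ ps ⟫ Δ)) Δ)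

  WFBlock-rename : ∀ S ps Δ → WFBlock S (⟪ ps ⟫ Δ) →
    WFBlock S (⟪ renameParams (fun π) ps ⟫ renameDecls (fun π) Δ)
  WFBlock-rename S ps Δ (ps-unique , Θ' , ⊢Δ) =
    subst Unique (sym (names-renameParams f ps)) (Unique-map⁺ fun-injective ps-unique) ,
    renameCtx f Θ' ,
    subst (λ Θ → DeclsWF S Θ (renameDecls f Δ) (renameCtx f Θ')) renameCtx-params
          (DeclsWF-rename f fun-injective ⊢Δ)
    where
    f : ℕ → ℕ
    f = fun π
    renameCtx-params : renameCtx f (sig⁻ S ++ paramCtx ps) ≡ sig⁻ S ++ paramCtx (renameParams f ps)
    renameCtx-params = begin
      renameCtx f (sig⁻ S ++ paramCtx ps)               ≡⟨ map-++ (renameEntry f) (sig⁻ S) (paramCtx ps) ⟩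
      renameCtx f (sig⁻ S) ++ renameCtx f (paramCtx ps) ≡⟨ cong₂ _++_ (renameCtx-sig⁻ f S) (renameCtx-paramCtx f ps) ⟩
      sig⁻ S ++ paramCtx (renameParams f ps)            ∎

theorem4p6 : (S : Sig) (B : Block) (π : Perm) → WFBlock S B →
    ∃ λ B' → permBlock S π B ≡ just B' × WFBlock S B'
theorem4p6 S (⟪ ps ⟫ Δ) π ⊢B = _ , permBlock-renames π S ps Δ , WFBlock-rename π S ps Δ ⊢B
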